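{- For every natural number $n \ge 1$, the number of partitions of $n$ into parts any two of which differ by at least $2$ equals the number of partitions of $n$ into pairwise distinct parts in which every odd part is strictly greater than twice the number of even parts of the partition.
   Context: A partition of a natural number $n$ is a representation of $n$ as a sum of positive integers (its parts), listed in non-increasing order; two partitions are the same if they have the same multiset of parts. "The number of even parts" means the number of parts of the partition that are even integers. -}

module Defs where

open import Data.Nat using (ℕ; _+_; _*_; _≤_; _<_)
open import Data.Nat.Divisibility using (_∣_; _∣?_)
open import Data.List using (List; []; _∷_; length; filter)
open import Data.Nat.ListAction using (sum)
open import Data.Unit using (⊤)
open import Data.List.Relation.Unary.All using (All)
open import Data.List.Relation.Unary.Linked using (Linked)
open import Data.Product using (_×_)
open import Relation.Binary.PropositionalEquality using (_≡_)
open import Relation.Nullary using (¬_)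
open import Data.Bool using (T; not; _∨_)
open import Data.Nat using (_≡ᵇ_; _<ᵇ_; _%_)

IsPartition : ℕ → List ℕ → Set
IsPartition n p = All (λ k → 1 ≤ k) p × Linked (λ a b → b ≤ a) p × sum p ≡ n

numEvenParts : List ℕ → ℕ
numEvenParts p = length (filter (2 ∣?_) p)

-- Any two parts differ by at least 2.  Since the list is non-increasing,
-- this is equivalent to consecutive parts differing by at least 2; we state it
-- literally for all pairs (earlier part a, later part b): b + 2 ≤ a.
DiffAtLeast2 : List ℕ → Set
DiffAtLeast2 [] = ⊤
DiffAtLeast2 (a ∷ p) = All (λ b → b + 2 ≤ a) p × DiffAtLeast2 p

-- Pairwise distinct parts (every earlier part differs from every later part);
-- a ≠ b is expressed with the boolean equality test so that proofs are unique.
Distinct : List ℕ → Set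
Distinct [] = ⊤
Distinct (a ∷ p) = All (λ b → T (not (a ≡ᵇ b))) p × Distinct p

-- Written as a
-- boolean test so that proofs of this property are unique (a bijection of
-- Σ-types then really counts partitions).
OddPartsLarge : List ℕ → Set
OddPartsLarge p = All (λ k → T ((k % 2 ≡ᵇ 0) ∨ (2 * numEvenParts p <ᵇ k))) p

{-# OPTIONS --safe #-}

-- Subtracting the staircase 2k − 1, …, 3, 1 from a partition of n into k parts that pairwise
-- differ by at least 2 leaves a non-increasing sequence μ of k naturals summing to n − k².
-- Split μ into its e odd and its m = k − e even entries.  Adding the staircase of length e to
-- the odd entries gives e distinct even parts; adding the staircase of length m to the even
-- entries and then 2e gives m distinct odd parts, all larger than 2e.  Altogether
-- e² + m² + 2em = k² has been added back, so these parts form a partition of n into distinct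
-- parts with exactly e even parts, whose odd parts exceed twice that number.  Each step is
-- invertible: the even parts determine e, and both staircases can be subtracted again.

module Submission where

open import Defs
open import Data.Bool using (T; not; _∨_)
open import Data.Bool.Properties using (T-≡; T-not-≡; T-∨; T-irrelevant; ¬-not)
open import Data.List using (List; []; _∷_; _++_; length; map; filter; merge)
open import Data.List.Properties using (length-++; filter-++; filter-all; filter-none)
open import Data.List.Relation.Binary.Permutation.Propositional
  using (_↭_; ↭⇒↭ₛ; ↭-sym; ↭-trans; ↭-reflexive; prep; module PermutationReasoning)
open import Data.List.Relation.Binary.Permutation.Propositional.Properties
  using (All-resp-↭; merge-↭; filter-↭; shift; ↭-length)
open import Data.List.Relation.Binary.Pointwise using (Pointwise-≡⇒≡)
open import Data.List.Relation.Unary.All as All using (All; []; _∷_)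
import Data.List.Relation.Unary.All.Properties as All
open import Data.List.Relation.Unary.AllPairs as AllPairs using (AllPairs; []; _∷_)
import Data.List.Relation.Unary.AllPairs.Properties as AllPairs
open import Data.List.Relation.Unary.Linked as Linked using (Linked; []; [-]; _∷_)
import Data.List.Relation.Unary.Linked.Properties as Linked
import Data.List.Relation.Unary.Sorted.TotalOrder.Properties as Sorted
open import Data.List.Relation.Unary.Unique.Propositional using (Unique)
open import Data.Nat using (ℕ; zero; suc; _+_; _*_; _∸_; _%_; _≡ᵇ_; _<ᵇ_; _≤_; _<_; _≥_; _>_; z≤n; z<s)
open import Data.Nat.Divisibility
  using (_∣_; _∤_; _∣?_; _∣0; ∣-refl; ∣1⇒≡1; m∣m*n; ∣m∣n⇒∣m+n; ∣m+n∣m⇒∣n; m%n≡0⇒n∣m; n∣m⇒m%n≡0)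
open import Data.Nat.ListAction using (sum)
open import Data.Nat.ListAction.Properties using (sum-++; sum-↭)
open import Data.Nat.Properties
open import Data.Nat.Tactic.RingSolver using (solve-∀)
open import Data.Product using (Σ; _×_; _,_)
open import Data.Product.Properties using (Σ-≡,≡→≡)
open import Data.Sum as Sum using (_⊎_; inj₁; inj₂; [_,_])
open import Data.Unit using (tt)
open import Function using (_∘_; id; case_of_)
open import Function.Bundles using (_↔_; _⇔_; mk↔ₛ′; mk⇔; Equivalence)
open import Function.Properties.Inverse using (↔-trans)
open import Relation.Binary.PropositionalEquality
  using (_≡_; _≢_; refl; sym; trans; cong; cong₂; subst; ≢-sym; setoid; module ≡-Reasoning)
open import Data.List.Relation.Binary.Permutation.Setoid.Properties (setoid ℕ) using (Unique-resp-↭)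
open import Relation.Nullary using (¬_; yes; no; contradiction)
open import Relation.Nullary.Decidable using (decidable-stable)
open import Relation.Nullary.Irrelevant using (Irrelevant)
open import Relation.Unary using (Pred; Decidable; ∁)
open import Relation.Unary.Properties using (∁?)
import Relation.Binary.Construct.Flip.EqAndOrd as Flip

private
  variable
    a b x : ℕ
    xs ys : List ℕ

NonIncreasing : List ℕ → Set
NonIncreasing = Linked _≥_

merge≥ : List ℕ → List ℕ → List ℕ
merge≥ = merge _≥?_

merge≥-[]ʳ : ∀ xs → merge≥ xs [] ≡ xs
merge≥-[]ʳ []      = refl
merge≥-[]ʳ (_ ∷ _) = refl

merge≥-↭ : ∀ xs ys → merge≥ xs ys ↭ xs ++ ys
merge≥-↭ = merge-↭ _≥?_

merge≥-nonIncreasing : NonIncreasing xs → NonIncreasing ys → NonIncreasing (merge≥ xs ys)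
merge≥-nonIncreasing = Sorted.merge⁺ (Flip.decTotalOrder ≤-decTotalOrder)

filter-nonIncreasing : ∀ {p} {P : Pred ℕ p} (P? : Decidable P) →
                       NonIncreasing xs → NonIncreasing (filter P? xs)
filter-nonIncreasing P? = Sorted.filter⁺ (Flip.totalOrder ≤-totalOrder) P?

nonIncreasing-↭⇒≡ : NonIncreasing xs → NonIncreasing ys → xs ↭ ys → xs ≡ ys
nonIncreasing-↭⇒≡ xs↘ ys↘ xs↭ys =
  Pointwise-≡⇒≡ (Sorted.↗↭↗⇒≋ (Flip.totalOrder ≤-totalOrder) xs↘ ys↘ (↭⇒↭ₛ xs↭ys))

module _ {p} {P : Pred ℕ p} (P? : Decidable P) where

  filter-∁-↭ : ∀ xs → filter P? xs ++ filter (∁? P?) xs ↭ xs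
  filter-∁-↭ []       = ↭-reflexive refl
  filter-∁-↭ (x ∷ xs) with P? x
  ... | yes _ = prep x (filter-∁-↭ xs)
  ... | no  _ = ↭-trans (shift x (filter P? xs) _) (prep x (filter-∁-↭ xs))

  merge≥-filter-∁ : NonIncreasing xs → merge≥ (filter P? xs) (filter (∁? P?) xs) ≡ xs
  merge≥-filter-∁ {xs} xs↘ = nonIncreasing-↭⇒≡
    (merge≥-nonIncreasing (filter-nonIncreasing P? xs↘) (filter-nonIncreasing (∁? P?) xs↘))
    xs↘
    (↭-trans (merge≥-↭ (filter P? xs) _) (filter-∁-↭ xs))

  filter-merge≥ : NonIncreasing xs → NonIncreasing ys →
                  filter P? (merge≥ xs ys) ≡ merge≥ (filter P? xs) (filter P? ys)
  filter-merge≥ {xs} {ys} xs↘ ys↘ = nonIncreasing-↭⇒≡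
    (filter-nonIncreasing P? (merge≥-nonIncreasing xs↘ ys↘))
    (merge≥-nonIncreasing (filter-nonIncreasing P? xs↘) (filter-nonIncreasing P? ys↘))
    (begin
      filter P? (merge≥ xs ys)             ↭⟨ filter-↭ P? (merge≥-↭ xs ys) ⟩
      filter P? (xs ++ ys)                 ≡⟨ filter-++ P? xs ys ⟩
      filter P? xs ++ filter P? ys         ↭⟨ ↭-sym (merge≥-↭ (filter P? xs) (filter P? ys)) ⟩
      merge≥ (filter P? xs) (filter P? ys) ∎)
    where open PermutationReasoning

  filter-merge≥-all : NonIncreasing xs → NonIncreasing ys → All P xs → All (∁ P) ys →
                      filter P? (merge≥ xs ys) ≡ xs
  filter-merge≥-all {xs} {ys} xs↘ ys↘ pxs ¬pys = begin
    filter P? (merge≥ xs ys)             ≡⟨ filter-merge≥ xs↘ ys↘ ⟩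
    merge≥ (filter P? xs) (filter P? ys) ≡⟨ cong₂ merge≥ (filter-all P? pxs) (filter-none P? ¬pys) ⟩
    merge≥ xs []                         ≡⟨ merge≥-[]ʳ xs ⟩
    xs                                   ∎
    where open ≡-Reasoning

  filter-merge≥-none : NonIncreasing xs → NonIncreasing ys → All (∁ P) xs → All P ys →
                       filter P? (merge≥ xs ys) ≡ ys
  filter-merge≥-none xs↘ ys↘ ¬pxs pys =
    trans (filter-merge≥ xs↘ ys↘) (cong₂ merge≥ (filter-none P? ¬pxs) (filter-all P? pys))

evens odds : List ℕ → List ℕ
evens = filter (2 ∣?_)
odds  = filter (∁? (2 ∣?_))

even⇒odd-suc : 2 ∣ a → 2 ∤ suc a
even⇒odd-suc {a} 2∣a 2∣1+a =
  case ∣1⇒≡1 (∣m+n∣m⇒∣n (subst (2 ∣_) (+-comm 1 a) 2∣1+a) 2∣a) of λ ()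

odd⇒even-suc : 2 ∤ a → 2 ∣ suc a
odd⇒even-suc {zero}        2∤0   = contradiction (2 ∣0) 2∤0
odd⇒even-suc {suc zero}    _     = ∣-refl
odd⇒even-suc {suc (suc a)} 2∤2+a = ∣m∣n⇒∣m+n ∣-refl (odd⇒even-suc (2∤2+a ∘ ∣m∣n⇒∣m+n ∣-refl))

even⇒¬odd : 2 ∣ a → ¬ (2 ∤ a)
even⇒¬odd 2∣a 2∤a = 2∤a 2∣a

odd⇒positive : 2 ∤ a → 0 < a
odd⇒positive {zero}  2∤0 = contradiction (2 ∣0) 2∤0
odd⇒positive {suc _} _   = z<s

even-2*+ : ∀ c → 2 ∣ a → 2 ∣ 2 * c + a
even-2*+ c = ∣m∣n⇒∣m+n (m∣m*n c)

odd-2*+ : ∀ c → 2 ∤ a → 2 ∤ 2 * c + a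
odd-2*+ c 2∤a 2∣2c+a = 2∤a (∣m+n∣m⇒∣n 2∣2c+a (m∣m*n c))

even⇒odd-stair : ∀ l {x} → 2 ∣ x → 2 ∤ suc (2 * l + x)
even⇒odd-stair l = even⇒odd-suc ∘ even-2*+ l

odd⇒even-stair : ∀ l {x} → 2 ∤ x → 2 ∣ suc (2 * l + x)
odd⇒even-stair l = odd⇒even-suc ∘ odd-2*+ l

even-stair⇒odd : ∀ l {x} → 2 ∣ suc (2 * l + x) → 2 ∤ x
even-stair⇒odd l 2∣stair 2∣x = even⇒odd-stair l 2∣x 2∣stair

odd-stair⇒even : ∀ l {x} → 2 ∤ suc (2 * l + x) → 2 ∣ x
odd-stair⇒even l {x} 2∤stair = decidable-stable (2 ∣? x) (2∤stair ∘ odd⇒even-stair l)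

infix 4 _≥2+_
_≥2+_ : ℕ → ℕ → Set
a ≥2+ b = 2 + b ≤ a

Gapped : List ℕ → Set
Gapped = Linked _≥2+_

>-trans : ∀ {c} → a > b → b > c → a > c
>-trans a>b b>c = <-trans b>c a>b

≥2+⇒> : a ≥2+ b → a > b
≥2+⇒> = <⇒≤

≥2+⇒≥ : a ≥2+ b → a ≥ b
≥2+⇒≥ = m+n≤o⇒n≤o 2

+-monoʳ-≥2+ : ∀ c → a ≥2+ b → c + a ≥2+ c + b
+-monoʳ-≥2+ {a} {b} c a≥2+b = subst (λ t → suc t ≤ c + a) (+-suc c b) (+-monoʳ-< c a≥2+b)

+-cancelˡ-≥2+ : ∀ c → c + a ≥2+ c + b → a ≥2+ b
+-cancelˡ-≥2+ {a} {b} c c+a≥2+c+b =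
  +-cancelˡ-< c (suc b) a (subst (λ t → suc t ≤ c + a) (sym (+-suc c b)) c+a≥2+c+b)

gapped⇒unique : Gapped xs → Unique xs
gapped⇒unique gaps =
  AllPairs.map >⇒≢ (Linked.Linked⇒AllPairs >-trans (Linked.map ≥2+⇒> gaps))

nonIncreasing∧unique⇒decreasing : NonIncreasing xs → Unique xs → Linked _>_ xs
nonIncreasing∧unique⇒decreasing []           _                  = []
nonIncreasing∧unique⇒decreasing [-]          _                  = [-]
nonIncreasing∧unique⇒decreasing (a≥b ∷ a≥bs) ((a≢b ∷ _) ∷ uniq) =
  ≤∧≢⇒< a≥b (≢-sym a≢b) ∷ nonIncreasing∧unique⇒decreasing a≥bs uniq

decreasing⇒gapped : ∀ {p} {P : Pred ℕ p} → (∀ {a} → P a → ¬ P (suc a)) →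
                    Linked _>_ xs → All P xs → Gapped xs
decreasing⇒gapped noSuc []           _ = []
decreasing⇒gapped noSuc [-]          _ = [-]
decreasing⇒gapped {P = P} noSuc (a>b ∷ a>bs) (pa ∷ pbs@(pb ∷ _)) =
  ≤∧≢⇒< a>b (λ 1+b≡a → noSuc pb (subst P (sym 1+b≡a) pa)) ∷ decreasing⇒gapped noSuc a>bs pbs

-- The staircase 2k − 1, …, 3, 1

addStaircase : List ℕ → List ℕ
addStaircase []       = []
addStaircase (x ∷ xs) = suc (2 * length xs + x) ∷ addStaircase xs

subStaircase : List ℕ → List ℕ
subStaircase []       = []
subStaircase (x ∷ xs) = x ∸ suc (2 * length xs) ∷ subStaircase xs

length-addStaircase : ∀ xs → length (addStaircase xs) ≡ length xs
length-addStaircase []       = refl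
length-addStaircase (_ ∷ xs) = cong suc (length-addStaircase xs)

length-subStaircase : ∀ xs → length (subStaircase xs) ≡ length xs
length-subStaircase []       = refl
length-subStaircase (_ ∷ xs) = cong suc (length-subStaircase xs)

subStaircase-addStaircase : ∀ xs → subStaircase (addStaircase xs) ≡ xs
subStaircase-addStaircase []       = refl
subStaircase-addStaircase (x ∷ xs) rewrite length-addStaircase xs =
  cong₂ _∷_ (m+n∸m≡n (2 * length xs) x) (subStaircase-addStaircase xs)

gapped-head-bound : Gapped (x ∷ xs) → All (0 <_) (x ∷ xs) → 2 * length xs < x
gapped-head-bound [-] (0<x ∷ []) = 0<x
gapped-head-bound {x} {y ∷ ys} (x≥2+y ∷ gaps) (_ ∷ positive) = begin-strict
  2 * suc (length ys) ≡⟨ *-suc 2 (length ys) ⟩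
  2 + 2 * length ys   <⟨ +-monoʳ-< 2 (gapped-head-bound gaps positive) ⟩
  2 + y               ≤⟨ x≥2+y ⟩
  x                   ∎
  where open ≤-Reasoning

addStaircase-subStaircase : Gapped xs → All (0 <_) xs → addStaircase (subStaircase xs) ≡ xs
addStaircase-subStaircase {[]}     _    _ = refl
addStaircase-subStaircase {x ∷ xs} gaps positive rewrite length-subStaircase xs =
  cong₂ _∷_ (m+[n∸m]≡n (gapped-head-bound gaps positive))
            (addStaircase-subStaircase (Linked.tail gaps) (All.tail positive))

addStaircase-positive : ∀ xs → All (0 <_) (addStaircase xs)
addStaircase-positive []       = []
addStaircase-positive (_ ∷ xs) = z<s ∷ addStaircase-positive xs

sum-addStaircase : ∀ xs → sum (addStaircase xs) ≡ length xs * length xs + sum xs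
sum-addStaircase []       = refl
sum-addStaircase (x ∷ xs) = begin
  suc (2 * l + x) + sum (addStaircase xs) ≡⟨ cong (suc (2 * l + x) +_) (sum-addStaircase xs) ⟩
  suc (2 * l + x) + (l * l + sum xs)       ≡⟨ expand l x (sum xs) ⟩
  suc l * suc l + (x + sum xs)             ∎
  where
  open ≡-Reasoning
  l : ℕ
  l = length xs
  expand : ∀ l x s → suc (2 * l + x) + (l * l + s) ≡ suc l * suc l + (x + s)
  expand = solve-∀

staircase-next : ∀ l a → suc (2 * suc l + a) ≡ 3 + (2 * l + a)
staircase-next = solve-∀

staircase-step : ∀ l → a ≥ b → suc (2 * suc l + a) ≥2+ suc (2 * l + b)
staircase-step {a} {b} l a≥b = begin
  3 + (2 * l + b)     ≤⟨ +-monoʳ-≤ (3 + 2 * l) a≥b ⟩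
  3 + (2 * l + a)     ≡⟨ staircase-next l a ⟨
  suc (2 * suc l + a) ∎
  where open ≤-Reasoning

staircase-step⁻ : ∀ l → suc (2 * suc l + a) ≥2+ suc (2 * l + b) → a ≥ b
staircase-step⁻ {a} {b} l step = +-cancelˡ-≤ (3 + 2 * l) b a (begin
  3 + (2 * l + b)     ≤⟨ step ⟩
  suc (2 * suc l + a) ≡⟨ staircase-next l a ⟩
  3 + (2 * l + a)     ∎)
  where open ≤-Reasoning

addStaircase-gapped : NonIncreasing xs → Gapped (addStaircase xs)
addStaircase-gapped []                                 = []
addStaircase-gapped [-]                                = [-]
addStaircase-gapped {_ ∷ _ ∷ ys} (a≥b ∷ nonIncreasing) =
  staircase-step (length ys) a≥b ∷ addStaircase-gapped nonIncreasing

addStaircase-gapped⁻ : ∀ xs → Gapped (addStaircase xs) → NonIncreasing xs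
addStaircase-gapped⁻ []           _             = []
addStaircase-gapped⁻ (_ ∷ [])     _             = [-]
addStaircase-gapped⁻ (_ ∷ _ ∷ ys) (step ∷ gaps) =
  staircase-step⁻ (length ys) step ∷ addStaircase-gapped⁻ (_ ∷ ys) gaps

module _ {p q} {P : Pred ℕ p} {Q : Pred ℕ q} where

  All-addStaircase⁺ : (∀ l {x} → P x → Q (suc (2 * l + x))) → All P xs → All Q (addStaircase xs)
  All-addStaircase⁺          f []         = []
  All-addStaircase⁺ {_ ∷ xs} f (px ∷ pxs) = f (length xs) px ∷ All-addStaircase⁺ f pxs

  All-addStaircase⁻ : (∀ l {x} → Q (suc (2 * l + x)) → P x) →
                      ∀ xs → All Q (addStaircase xs) → All P xs
  All-addStaircase⁻ f []       []         = []
  All-addStaircase⁻ f (_ ∷ xs) (qx ∷ qxs) = f (length xs) qx ∷ All-addStaircase⁻ f xs qxs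

map-∸-+ : ∀ c xs → map (_∸ c) (map (c +_) xs) ≡ xs
map-∸-+ c []       = refl
map-∸-+ c (x ∷ xs) = cong₂ _∷_ (m+n∸m≡n c x) (map-∸-+ c xs)

map-+-∸ : ∀ c → All (c ≤_) xs → map (c +_) (map (_∸ c) xs) ≡ xs
map-+-∸ c []           = refl
map-+-∸ c (c≤x ∷ c≤xs) = cong₂ _∷_ (m+[n∸m]≡n c≤x) (map-+-∸ c c≤xs)

sum-map-+ : ∀ c xs → sum (map (c +_) xs) ≡ length xs * c + sum xs
sum-map-+ c []       = refl
sum-map-+ c (x ∷ xs) = begin
  c + x + sum (map (c +_) xs)      ≡⟨ cong (c + x +_) (sum-map-+ c xs) ⟩
  c + x + (length xs * c + sum xs) ≡⟨ rearrange c x (length xs) (sum xs) ⟩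
  c + length xs * c + (x + sum xs) ∎
  where
  open ≡-Reasoning
  rearrange : ∀ c x l s → c + x + (l * c + s) ≡ c + l * c + (x + s)
  rearrange = solve-∀

diffAtLeast2⇒gapped : ∀ xs → DiffAtLeast2 xs → Gapped xs
diffAtLeast2⇒gapped []           _                   = []
diffAtLeast2⇒gapped (_ ∷ [])     _                   = [-]
diffAtLeast2⇒gapped (a ∷ b ∷ xs) ((b+2≤a ∷ _) , rest) =
  subst (_≤ a) (+-comm b 2) b+2≤a ∷ diffAtLeast2⇒gapped (b ∷ xs) rest

gapped⇒diffAtLeast2 : Gapped xs → DiffAtLeast2 xs
gapped⇒diffAtLeast2 =
  fromAllPairs ∘ Linked.Linked⇒AllPairs (λ a≥2+b b≥2+c → ≤-trans b≥2+c (≥2+⇒≥ a≥2+b))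
  where
  fromAllPairs : AllPairs _≥2+_ xs → DiffAtLeast2 xs
  fromAllPairs []                      = tt
  fromAllPairs {a ∷ _} (a≥2+bs ∷ rest) =
    All.map (λ {b} → subst (_≤ a) (+-comm 2 b)) a≥2+bs , fromAllPairs rest

≢⇒T-not-≡ᵇ : a ≢ b → T (not (a ≡ᵇ b))
≢⇒T-not-≡ᵇ {a} {b} a≢b = Equivalence.from T-not-≡ (¬-not (a≢b ∘ ≡ᵇ⇒≡ a b ∘ Equivalence.from T-≡))

T-not-≡ᵇ⇒≢ : T (not (a ≡ᵇ b)) → a ≢ b
T-not-≡ᵇ⇒≢ {a} {b} a≢ᵇb a≡b = subst T (Equivalence.to T-not-≡ a≢ᵇb) (≡⇒≡ᵇ a b a≡b)

distinct⇒unique : ∀ xs → Distinct xs → Unique xs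
distinct⇒unique []       _             = []
distinct⇒unique (_ ∷ xs) (a≢xs , rest) = All.map T-not-≡ᵇ⇒≢ a≢xs ∷ distinct⇒unique xs rest

unique⇒distinct : Unique xs → Distinct xs
unique⇒distinct []            = tt
unique⇒distinct (a≢xs ∷ rest) = All.map ≢⇒T-not-≡ᵇ a≢xs , unique⇒distinct rest

oddPartTest⇔ : ∀ {k m} → T ((k % 2 ≡ᵇ 0) ∨ (m <ᵇ k)) ⇔ (2 ∣ k ⊎ m < k)
oddPartTest⇔ {k} {m} = mk⇔
  (Sum.map (m%n≡0⇒n∣m k 2 ∘ ≡ᵇ⇒≡ (k % 2) 0) (<ᵇ⇒< m k) ∘ Equivalence.to T-∨)
  (Equivalence.from T-∨ ∘ Sum.map (≡⇒≡ᵇ (k % 2) 0 ∘ n∣m⇒m%n≡0 k 2) <⇒<ᵇ)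

×-irrelevant : ∀ {A B : Set} → Irrelevant A → Irrelevant B → Irrelevant (A × B)
×-irrelevant A-irr B-irr (a₁ , b₁) (a₂ , b₂) = cong₂ _,_ (A-irr a₁ a₂) (B-irr b₁ b₂)

isPartition-irrelevant : ∀ {n xs} → Irrelevant (IsPartition n xs)
isPartition-irrelevant =
  ×-irrelevant (All.irrelevant ≤-irrelevant) (×-irrelevant (Linked.irrelevant ≤-irrelevant) ≡-irrelevant)

diffAtLeast2-irrelevant : ∀ xs → Irrelevant (DiffAtLeast2 xs)
diffAtLeast2-irrelevant []       = λ _ _ → refl
diffAtLeast2-irrelevant (_ ∷ xs) =
  ×-irrelevant (All.irrelevant ≤-irrelevant) (diffAtLeast2-irrelevant xs)

distinct-irrelevant : ∀ xs → Irrelevant (Distinct xs)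
distinct-irrelevant []       = λ _ _ → refl
distinct-irrelevant (_ ∷ xs) = ×-irrelevant (All.irrelevant T-irrelevant) (distinct-irrelevant xs)

module _ {A : Set} {P Q : A → Set}
         (P-irrelevant : ∀ {x} → Irrelevant (P x)) (Q-irrelevant : ∀ {y} → Irrelevant (Q y)) where

  restrict-↔ : (f g : A → A) → (∀ {x} → P x → Q (f x)) → (∀ {y} → Q y → P (g y)) →
               (∀ {y} → Q y → f (g y) ≡ y) → (∀ {x} → P x → g (f x) ≡ x) →
               Σ A P ↔ Σ A Q
  restrict-↔ f g f-P⇒Q g-Q⇒P f∘g g∘f = mk↔ₛ′
    (λ (x , px) → f x , f-P⇒Q px)
    (λ (y , qy) → g y , g-Q⇒P qy)
    (λ (_ , qy) → Σ-≡,≡→≡ (f∘g qy , Q-irrelevant _ _))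
    (λ (_ , px) → Σ-≡,≡→≡ (g∘f px , P-irrelevant _ _))

GapTwoPartition : ℕ → List ℕ → Set
GapTwoPartition n xs = IsPartition n xs × DiffAtLeast2 xs

DistinctOddLargePartition : ℕ → List ℕ → Set
DistinctOddLargePartition n xs = IsPartition n xs × Distinct xs × OddPartsLarge xs

-- μ encodes a partition of n − k² into at most k parts, padded with zeros to length k = length μ.
Reduced : ℕ → List ℕ → Set
Reduced n μ = NonIncreasing μ × length μ * length μ + sum μ ≡ n

gapTwoPartition-irrelevant : ∀ {n xs} → Irrelevant (GapTwoPartition n xs)
gapTwoPartition-irrelevant = ×-irrelevant isPartition-irrelevant (diffAtLeast2-irrelevant _)

distinctOddLargePartition-irrelevant : ∀ {n xs} → Irrelevant (DistinctOddLargePartition n xs)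
distinctOddLargePartition-irrelevant =
  ×-irrelevant isPartition-irrelevant (×-irrelevant (distinct-irrelevant _) (All.irrelevant T-irrelevant))

reduced-irrelevant : ∀ {n μ} → Irrelevant (Reduced n μ)
reduced-irrelevant = ×-irrelevant (Linked.irrelevant ≤-irrelevant) ≡-irrelevant

gapTwo↔reduced : ∀ n → Σ (List ℕ) (GapTwoPartition n) ↔ Σ (List ℕ) (Reduced n)
gapTwo↔reduced n = restrict-↔ gapTwoPartition-irrelevant reduced-irrelevant
  subStaircase addStaircase reduce unreduce
  (λ _ → subStaircase-addStaircase _)
  (λ ((positive , _) , diff) → addStaircase-subStaircase (diffAtLeast2⇒gapped _ diff) positive)
  where
  reduce : GapTwoPartition n xs → Reduced n (subStaircase xs)
  reduce {xs} ((positive , _ , sum≡n) , diff) =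
    addStaircase-gapped⁻ μ (subst Gapped (sym restore) gaps) , (begin
      length μ * length μ + sum μ ≡⟨ sum-addStaircase μ ⟨
      sum (addStaircase μ)        ≡⟨ cong sum restore ⟩
      sum xs                      ≡⟨ sum≡n ⟩
      n                           ∎)
    where
    open ≡-Reasoning
    μ : List ℕ
    μ = subStaircase xs
    gaps : Gapped xs
    gaps = diffAtLeast2⇒gapped xs diff
    restore : addStaircase μ ≡ xs
    restore = addStaircase-subStaircase gaps positive

  unreduce : Reduced n xs → GapTwoPartition n (addStaircase xs)
  unreduce {xs} (xs↘ , weight) =
    (addStaircase-positive xs , Linked.map ≥2+⇒≥ gaps , trans (sum-addStaircase xs) weight) ,
    gapped⇒diffAtLeast2 gaps
    where
    gaps : Gapped (addStaircase xs)
    gaps = addStaircase-gapped xs↘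

-- Splitting by parity

toDistinct : List ℕ → List ℕ
toDistinct μ =
  merge≥ (addStaircase (odds μ)) (map (2 * length (odds μ) +_) (addStaircase (evens μ)))

-- The odd parts of a partition in the image of toDistinct exceed 2e, where e is the number of
-- its even parts, so the truncated subtraction below is exact there.
fromDistinct : List ℕ → List ℕ
fromDistinct ν =
  merge≥ (subStaircase (map (_∸ 2 * length (evens ν)) (odds ν))) (subStaircase (evens ν))

sum-toDistinct : ∀ μ → sum (toDistinct μ) ≡ length μ * length μ + sum μ
sum-toDistinct μ = begin
  sum (toDistinct μ)                                ≡⟨ sum-↭ (merge≥-↭ A B) ⟩
  sum (A ++ B)                                      ≡⟨ sum-++ A B ⟩
  sum A + sum B                                     ≡⟨ cong₂ _+_ (sum-addStaircase O) sum-B ⟩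
  (e * e + sum O) + (m * (2 * e) + (m * m + sum E)) ≡⟨ square-of-sum e m (sum O) (sum E) ⟩
  (m + e) * (m + e) + (sum E + sum O)               ≡⟨ cong₂ (λ k s → k * k + s) length-split sum-split ⟩
  length μ * length μ + sum μ                       ∎
  where
  open ≡-Reasoning
  O E A B : List ℕ
  O = odds μ
  E = evens μ
  A = addStaircase O
  B = map (2 * length O +_) (addStaircase E)
  e m : ℕ
  e = length O
  m = length E
  sum-B : sum B ≡ m * (2 * e) + (m * m + sum E)
  sum-B = trans (sum-map-+ (2 * e) (addStaircase E))
                (cong₂ (λ k s → k * (2 * e) + s) (length-addStaircase E) (sum-addStaircase E))
  split : E ++ O ↭ μ
  split = filter-∁-↭ (2 ∣?_) μ
  length-split : m + e ≡ length μ
  length-split = trans (sym (length-++ E)) (↭-length split)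
  sum-split : sum E + sum O ≡ sum μ
  sum-split = trans (sym (sum-++ E O)) (sum-↭ split)
  square-of-sum : ∀ e m s t →
                  (e * e + s) + (m * (2 * e) + (m * m + t)) ≡ (m + e) * (m + e) + (t + s)
  square-of-sum = solve-∀

module ToDistinct {μ : List ℕ} (μ↘ : NonIncreasing μ) where

  O E : List ℕ
  O = odds μ
  E = evens μ

  e : ℕ
  e = length O

  A B ν : List ℕ
  A = addStaircase O
  B = map (2 * e +_) (addStaircase E)
  ν = toDistinct μ

  A-gapped : Gapped A
  A-gapped = addStaircase-gapped (filter-nonIncreasing _ μ↘)

  B-gapped : Gapped B
  B-gapped = Linked.map⁺
    (Linked.map (+-monoʳ-≥2+ (2 * e)) (addStaircase-gapped (filter-nonIncreasing _ μ↘)))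

  A↘ : NonIncreasing A
  A↘ = Linked.map ≥2+⇒≥ A-gapped

  B↘ : NonIncreasing B
  B↘ = Linked.map ≥2+⇒≥ B-gapped

  A-even : All (2 ∣_) A
  A-even = All-addStaircase⁺ odd⇒even-stair (All.all-filter (∁? (2 ∣?_)) μ)

  B-odd : All (2 ∤_) B
  B-odd = All.map⁺
    (All-addStaircase⁺ (λ l → odd-2*+ e ∘ even⇒odd-stair l) (All.all-filter (2 ∣?_) μ))

  B-large : All (2 * e <_) B
  B-large = All.map⁺ (All.map (m<m+n (2 * e)) (addStaircase-positive E))

  evens-ν : evens ν ≡ A
  evens-ν = filter-merge≥-all (2 ∣?_) A↘ B↘ A-even B-odd

  odds-ν : odds ν ≡ B
  odds-ν = filter-merge≥-none (∁? (2 ∣?_)) A↘ B↘ (All.map even⇒¬odd A-even) B-odd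

  numEvenParts-ν : numEvenParts ν ≡ e
  numEvenParts-ν = trans (cong length evens-ν) (length-addStaircase O)

  fromDistinct-toDistinct : fromDistinct ν ≡ μ
  fromDistinct-toDistinct = begin
    fromDistinct ν
      ≡⟨ cong₂ (λ ev od → merge≥ (subStaircase (map (_∸ 2 * length ev) od)) (subStaircase ev))
               evens-ν odds-ν ⟩
    merge≥ (subStaircase (map (_∸ 2 * length A) B)) (subStaircase A)
      ≡⟨ cong (λ k → merge≥ (subStaircase (map (_∸ 2 * k) B)) (subStaircase A))
              (length-addStaircase O) ⟩
    merge≥ (subStaircase (map (_∸ 2 * e) B)) (subStaircase A)
      ≡⟨ cong₂ (λ xs ys → merge≥ (subStaircase xs) ys)
               (map-∸-+ (2 * e) (addStaircase E)) (subStaircase-addStaircase O) ⟩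
    merge≥ (subStaircase (addStaircase E)) O
      ≡⟨ cong (λ xs → merge≥ xs O) (subStaircase-addStaircase E) ⟩
    merge≥ E O
      ≡⟨ merge≥-filter-∁ (2 ∣?_) μ↘ ⟩
    μ ∎
    where open ≡-Reasoning

  isDistinctOddLarge : ∀ {n} → length μ * length μ + sum μ ≡ n → DistinctOddLargePartition n ν
  isDistinctOddLarge weight =
    (positive , merge≥-nonIncreasing A↘ B↘ , trans (sum-toDistinct μ) weight) , distinct , oddPartsLarge
    where
    A++B↭ν : A ++ B ↭ ν
    A++B↭ν = ↭-sym (merge≥-↭ A B)
    positive : All (0 <_) ν
    positive = All-resp-↭ A++B↭ν
      (All.++⁺ (addStaircase-positive O) (All.map (≤-<-trans z≤n) B-large))
    A≢B : All (λ a → All (a ≢_) B) A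
    A≢B = All.map (λ 2∣a → All.map (λ 2∤b a≡b → 2∤b (subst (2 ∣_) a≡b 2∣a)) B-odd) A-even
    distinct : Distinct ν
    distinct = unique⇒distinct (Unique-resp-↭ (↭⇒↭ₛ A++B↭ν)
      (AllPairs.++⁺ (gapped⇒unique A-gapped) (gapped⇒unique B-gapped) A≢B))
    oddPartsLarge : OddPartsLarge ν
    oddPartsLarge = All.map (Equivalence.from oddPartTest⇔) (All-resp-↭ A++B↭ν (All.++⁺
      (All.map inj₁ A-even)
      (All.map inj₂ (subst (λ k → All (2 * k <_) B) (sym numEvenParts-ν) B-large))))

module FromDistinct {ν : List ℕ} (ν-positive : All (0 <_) ν) (ν↘ : NonIncreasing ν)
                    (ν-distinct : Distinct ν) (ν-large : OddPartsLarge ν) where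

  Ev Od : List ℕ
  Ev = evens ν
  Od = odds ν

  e : ℕ
  e = length Ev

  Od′ O E μ : List ℕ
  Od′ = map (_∸ 2 * e) Od
  O = subStaircase Ev
  E = subStaircase Od′
  μ = fromDistinct ν

  ν-decreasing : Linked _>_ ν
  ν-decreasing = nonIncreasing∧unique⇒decreasing ν↘ (distinct⇒unique ν ν-distinct)

  Ev-gapped : Gapped Ev
  Ev-gapped = decreasing⇒gapped even⇒odd-suc
    (Linked.filter⁺ (2 ∣?_) >-trans ν-decreasing) (All.all-filter (2 ∣?_) ν)

  Od-gapped : Gapped Od
  Od-gapped = decreasing⇒gapped (λ 2∤a → even⇒¬odd (odd⇒even-suc 2∤a))
    (Linked.filter⁺ (∁? (2 ∣?_)) >-trans ν-decreasing) (All.all-filter (∁? (2 ∣?_)) ν)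

  Od-large : All (2 * e <_) Od
  Od-large = All.zipWith (λ (2∤k , test) → [ (λ 2∣k → contradiction 2∣k 2∤k) , id ] test)
    ( All.all-filter (∁? (2 ∣?_)) ν
    , All.filter⁺ (∁? (2 ∣?_)) (All.map (Equivalence.to oddPartTest⇔) ν-large))

  Od-restore : map (2 * e +_) Od′ ≡ Od
  Od-restore = map-+-∸ (2 * e) (All.map <⇒≤ Od-large)

  Od′-gapped : Gapped Od′
  Od′-gapped = Linked.map (+-cancelˡ-≥2+ (2 * e))
    (Linked.map⁻ (subst Gapped (sym Od-restore) Od-gapped))

  Od′-odd : All (2 ∤_) Od′
  Od′-odd = All.map (λ 2∤2e+x → 2∤2e+x ∘ even-2*+ e)
    (All.map⁻ (subst (All (2 ∤_)) (sym Od-restore) (All.all-filter (∁? (2 ∣?_)) ν)))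

  Ev-restore : addStaircase O ≡ Ev
  Ev-restore = addStaircase-subStaircase Ev-gapped (All.filter⁺ (2 ∣?_) ν-positive)

  Od′-restore : addStaircase E ≡ Od′
  Od′-restore = addStaircase-subStaircase Od′-gapped (All.map odd⇒positive Od′-odd)

  O↘ : NonIncreasing O
  O↘ = addStaircase-gapped⁻ O (subst Gapped (sym Ev-restore) Ev-gapped)

  E↘ : NonIncreasing E
  E↘ = addStaircase-gapped⁻ E (subst Gapped (sym Od′-restore) Od′-gapped)

  O-odd : All (2 ∤_) O
  O-odd = All-addStaircase⁻ even-stair⇒odd O
    (subst (All (2 ∣_)) (sym Ev-restore) (All.all-filter (2 ∣?_) ν))

  E-even : All (2 ∣_) E
  E-even = All-addStaircase⁻ odd-stair⇒even E (subst (All (2 ∤_)) (sym Od′-restore) Od′-odd)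

  μ↘ : NonIncreasing μ
  μ↘ = merge≥-nonIncreasing E↘ O↘

  toDistinct-fromDistinct : toDistinct μ ≡ ν
  toDistinct-fromDistinct = begin
    toDistinct μ
      ≡⟨ cong₂ (λ od ev → merge≥ (addStaircase od) (map (2 * length od +_) (addStaircase ev)))
               odds-μ evens-μ ⟩
    merge≥ (addStaircase O) (map (2 * length O +_) (addStaircase E))
      ≡⟨ cong₂ (λ k xs → merge≥ (addStaircase O) (map (2 * k +_) xs))
               (length-subStaircase Ev) Od′-restore ⟩
    merge≥ (addStaircase O) (map (2 * e +_) Od′)
      ≡⟨ cong₂ merge≥ Ev-restore Od-restore ⟩
    merge≥ Ev Od
      ≡⟨ merge≥-filter-∁ (2 ∣?_) ν↘ ⟩
    ν ∎
    where
    open ≡-Reasoning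
    odds-μ : odds μ ≡ O
    odds-μ = filter-merge≥-none (∁? (2 ∣?_)) E↘ O↘ (All.map even⇒¬odd E-even) O-odd
    evens-μ : evens μ ≡ E
    evens-μ = filter-merge≥-all (2 ∣?_) E↘ O↘ E-even O-odd

  isReduced : ∀ {n} → sum ν ≡ n → Reduced n μ
  isReduced {n} sum≡n = μ↘ , (begin
    length μ * length μ + sum μ ≡⟨ sum-toDistinct μ ⟨
    sum (toDistinct μ)          ≡⟨ cong sum toDistinct-fromDistinct ⟩
    sum ν                       ≡⟨ sum≡n ⟩
    n                           ∎)
    where open ≡-Reasoning

reduced↔distinctOddLarge : ∀ n → Σ (List ℕ) (Reduced n) ↔ Σ (List ℕ) (DistinctOddLargePartition n)
reduced↔distinctOddLarge n = restrict-↔ reduced-irrelevant distinctOddLargePartition-irrelevant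
  toDistinct fromDistinct
  (λ (μ↘ , weight) → ToDistinct.isDistinctOddLarge μ↘ weight)
  (λ ((positive , ν↘ , sum≡n) , distinct , large) →
     FromDistinct.isReduced positive ν↘ distinct large sum≡n)
  (λ ((positive , ν↘ , _) , distinct , large) →
     FromDistinct.toDistinct-fromDistinct positive ν↘ distinct large)
  (λ (μ↘ , _) → ToDistinct.fromDistinct-toDistinct μ↘)

mainTheorem1 : (n : ℕ) → 1 ≤ n →
    (Σ (List ℕ) λ p → IsPartition n p × DiffAtLeast2 p)
      ↔ (Σ (List ℕ) λ p → IsPartition n p × Distinct p × OddPartsLarge p)
mainTheorem1 n _ = ↔-trans (gapTwo↔reduced n) (reduced↔distinctOddLarge n)
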